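{- In diminished disjunctive compound Node-Kayles under normal play, the set $\mathcal{L}$ of integers $n\ge 0$ such that the single path $P_n$ is a $\mathcal{P}$-position is $$\mathcal{L}=\{0,4,5,9,10,14,28,50,54,98\}.$$
   Context: For $n\ge 0$, $P_n$ denotes the path on $n$ vertices ($P_0$ is the empty graph). A Node-Kayles move on a path $P_k$ with $k\ge 1$ chooses a vertex $v$ and deletes $v$ together with its neighbours. The possible results are: $P_0$ if $k\in\{1,2\}$; $P_0$ or $P_1$ if $k=3$; and, for $k\ge 4$, $P_{k-2}$, $P_{k-3}$, or two paths $P_i, P_j$ with $j\ge i\ge 1$, $i+j=k-3$. Diminished disjunctive compound Node-Kayles is played by two players who move alternately. A position is a finite multiset of paths, called its components, and the starting position is a single path. A move consists of choosing exactly one nonempty component $P_k$ and replacing it by the result of a Node-Kayles move on it; the result may be the empty path $P_0$, one nonempty path, or two nonempty paths, which then become separate components. The game ends as soon as some component is the empty path $P_0$ (short ending rule), or when no move is available. Under normal play, the player who made the last move wins. A position is a $\mathcal{P}$-position if the player who does not move next (the second player) has a winning strategy, and an $\mathcal{N}$-position otherwise. In particular, $P_0$ is a $\mathcal{P}$-position. -}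

module Defs where

open import Data.Nat using (ℕ; zero; suc; _+_; _≤_)
open import Data.List using (List; []; _∷_; _++_)
open import Data.List.Membership.Propositional using (_∈_)
open import Relation.Nullary using (¬_)

-- A position is a finite multiset of paths, represented as a list of
-- path lengths (order is irrelevant: a move may act on any component).
Position : Set
Position = List ℕ

-- Node-Kayles move on a single path P_k: the list of resulting components.
-- (0 ∷ []) stands for the empty path P_0.
data KaylesMove : ℕ → List ℕ → Set where
  one     : KaylesMove 1 (0 ∷ [])
  two     : KaylesMove 2 (0 ∷ [])
  three₀  : KaylesMove 3 (0 ∷ [])
  three₁  : KaylesMove 3 (1 ∷ [])
  endTwo  : ∀ m → KaylesMove (4 + m) (2 + m ∷ [])
  endOne  : ∀ m → KaylesMove (4 + m) (1 + m ∷ [])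
  split   : ∀ i j → 1 ≤ i → i ≤ j →
            KaylesMove (3 + (i + j)) (i ∷ j ∷ [])

data Move : Position → Position → Set where
  move : ∀ xs ys k r → KaylesMove k r → Move (xs ++ k ∷ ys) (xs ++ r ++ ys)

-- Short ending rule: the game is over once some component is P_0.
Ended : Position → Set
Ended pos = 0 ∈ pos

mutual
  data IsP : Position → Set where
    ended  : ∀ {pos} → Ended pos → IsP pos
    allToN : ∀ {pos} → ¬ Ended pos →
             (∀ pos′ → Move pos pos′ → IsN pos′) → IsP pos

  data IsN : Position → Set where
    toP : ∀ {pos} pos′ → ¬ Ended pos → Move pos pos′ → IsP pos′ → IsN pos

-- A component P₁, P₂ or P₃ lets the player to move end the game at once, so
-- creating one loses: on positions whose components all have length at least
-- 4 the game is the disjunctive sum of the Node-Kayles variant in which moves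
-- leaving a path of length 1, 2 or 3 are forbidden.  By the Sprague–Grundy
-- theory such a position is a P-position iff the nim-sum of the Grundy values
-- g(k) of its components vanishes.  The sequence g is periodic from 245 on,
-- with period 84: as in the Guy–Smith periodicity theorem, the mex recurrence
-- for k < 2·245 + 2·84 + 3 = 661 implies it for all k, because beyond that
-- bound the options of P_{k+84} and P_k correspond with equal values.  That
-- finite recurrence, and the zeros 4, 5, 9, 10, 14, 28, 50, 54, 98 of g beyond
-- 3, are checked by evaluation.
module Submission where

open import Defs
open import Data.Nat using (ℕ)
open import Data.List using (List; []; _∷_)
open import Data.List.Membership.Propositional using (_∈_)
open import Function.Bundles using (_⇔_)

open import Data.Bool using (Bool; true; false; not; _xor_; _∧_; _∨_; T; if_then_else_)
import Data.Bool.Base as Bool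
import Data.Bool.Properties as Boolₚ
open import Data.Bool.Properties using (xor-assoc; xor-comm; xor-identityˡ; xor-identityʳ; xor-same; T-∧)
open import Data.Bool.ListAction using (all; any)
open import Data.Empty using (⊥)
open import Data.Unit using (tt)
open import Data.Nat
  using (zero; suc; _+_; _∸_; _^_; _/_; _%_; _≤_; _<_; _≤ᵇ_; _<ᵇ_; s≤s; z≤n; ⌊_/2⌋; NonZero; >-nonZero⁻¹)
open import Data.Nat.Properties
open import Data.Nat.DivMod using ([m+n]%n≡m%n; m%n<n)
open import Data.Nat.Induction using (<-rec; <-wellFounded)
open import Data.Nat.ListAction using (sum)
open import Data.Nat.ListAction.Properties using (sum-++)
open import Data.Nat.Tactic.RingSolver using (solve-∀)
open import Data.List using (_++_; map; foldr; filter; drop; upTo; applyDownFrom)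
open import Data.List.Properties using (map-++)
open import Data.List.Relation.Unary.All as All using (All; []; _∷_; all?)
open import Data.List.Relation.Unary.All.Properties using (all⁺; ++⁺; ++⁻ˡ; ++⁻ʳ; ¬All⇒Any¬)
open import Data.List.Relation.Unary.Any using (Any; here; there)
import Data.List.Relation.Unary.Any as Any
import Data.List.Relation.Unary.Any.Properties as Any
open import Data.List.Relation.Unary.Any.Properties using (any⁺; any⁻)
open import Data.List.Membership.Propositional using (_∉_; find)
open import Data.List.Membership.Propositional.Properties
  using (∈-∃++; ∈-++⁺ˡ; ∈-++⁺ʳ; ∈-++⁻; ∈-filter⁺; ∈-filter⁻; ∈-map⁺; ∈-map⁻;
         ∈-applyDownFrom⁺; ∈-applyDownFrom⁻; ∈-upTo⁺)
open import Data.List.Membership.DecPropositional _≟_ using (_∈?_)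
open import Data.Product using (_×_; _,_; proj₁; proj₂; ∃-syntax)
open import Data.Sum using (_⊎_; inj₁; inj₂)
open import Data.Vec using (Vec; []; _∷_; head; tail; zipWith; replicate)
open import Data.Vec.Properties using (zipWith-assoc; zipWith-comm; zipWith-identityˡ; zipWith-identityʳ)
open import Data.Vec.Relation.Binary.Lex.Strict using (Lex-<; this; next; <-decidable)
open import Function using (_∘_; _on_; case_of_)
open import Function.Bundles using (Equivalence; mk⇔)
open import Induction.WellFounded as WF using ()
import Relation.Binary.Construct.On as On
open import Relation.Binary.Definitions using (DecidableEquality)
open import Relation.Binary.PropositionalEquality
  using (_≡_; _≢_; refl; sym; trans; cong; cong₂; subst; module ≡-Reasoning)
open import Relation.Nullary using (¬_; Dec; yes; no; contradiction; ¬?; _×-dec_; _→-dec_)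
open import Relation.Nullary.Decidable using (isYes; toWitness; fromWitness)
open import Relation.Unary using (Decidable)

private variable
  n k : ℕ
  r pos : Position

-- Nimbers of n bits, most significant bit first: ⊕ is nim-addition and the
-- lexicographic order _<ᴺ_ is the numeric order of the binary numerals.
Nimber : ℕ → Set
Nimber = Vec Bool

0ᴺ : Nimber n
0ᴺ = replicate _ false

infixr 6 _⊕_
_⊕_ : Nimber n → Nimber n → Nimber n
_⊕_ = zipWith _xor_

infix 4 _<ᴺ_
_<ᴺ_ : Nimber n → Nimber n → Set
_<ᴺ_ = Lex-< _≡_ Bool._<_

⊕-assoc : ∀ (x y z : Nimber n) → (x ⊕ y) ⊕ z ≡ x ⊕ (y ⊕ z)
⊕-assoc = zipWith-assoc xor-assoc

⊕-comm : ∀ (x y : Nimber n) → x ⊕ y ≡ y ⊕ x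
⊕-comm = zipWith-comm xor-comm

⊕-identityˡ : ∀ (x : Nimber n) → 0ᴺ ⊕ x ≡ x
⊕-identityˡ = zipWith-identityˡ xor-identityˡ

⊕-identityʳ : ∀ (x : Nimber n) → x ⊕ 0ᴺ ≡ x
⊕-identityʳ = zipWith-identityʳ xor-identityʳ

⊕-self : ∀ (x : Nimber n) → x ⊕ x ≡ 0ᴺ
⊕-self []      = refl
⊕-self (b ∷ x) = cong₂ _∷_ (xor-same b) (⊕-self x)

⊕-cancelˡ : ∀ (x y : Nimber n) → x ⊕ (x ⊕ y) ≡ y
⊕-cancelˡ x y = begin
  x ⊕ (x ⊕ y) ≡⟨ ⊕-assoc x x y ⟨
  (x ⊕ x) ⊕ y ≡⟨ cong (_⊕ y) (⊕-self x) ⟩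
  0ᴺ ⊕ y      ≡⟨ ⊕-identityˡ y ⟩
  y           ∎
  where open ≡-Reasoning

⊕≡0⇒≡ : ∀ {x y : Nimber n} → x ⊕ y ≡ 0ᴺ → x ≡ y
⊕≡0⇒≡ {x = x} {y} x⊕y≡0 = begin
  x           ≡⟨ ⊕-identityʳ x ⟨
  x ⊕ 0ᴺ      ≡⟨ cong (x ⊕_) x⊕y≡0 ⟨
  x ⊕ (x ⊕ y) ≡⟨ ⊕-cancelˡ x y ⟩
  y           ∎
  where open ≡-Reasoning

nimSum : List (Nimber n) → Nimber n
nimSum = foldr _⊕_ 0ᴺ

nimSum-++ : ∀ (xs ys : List (Nimber n)) → nimSum (xs ++ ys) ≡ nimSum xs ⊕ nimSum ys
nimSum-++ []       ys = sym (⊕-identityˡ (nimSum ys))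
nimSum-++ (x ∷ xs) ys = trans (cong (x ⊕_) (nimSum-++ xs ys)) (sym (⊕-assoc x (nimSum xs) (nimSum ys)))

nimSum-∷ : ∀ (xs : List (Nimber (suc n))) →
           nimSum xs ≡ foldr _xor_ false (map head xs) ∷ nimSum (map tail xs)
nimSum-∷ []             = refl
nimSum-∷ ((b ∷ x) ∷ xs) = cong ((b ∷ x) ⊕_) (nimSum-∷ xs)

xor≡true⇒any : ∀ bs → foldr _xor_ false bs ≡ true → Any (_≡ true) bs
xor≡true⇒any (true  ∷ bs) _  = here refl
xor≡true⇒any (false ∷ bs) eq = there (xor≡true⇒any bs eq)

-- The leading bit of a non-zero nim-sum is set in some summand a, and adding
-- the nim-sum to a clears that bit while keeping the higher ones.
nimSum-reducible : ∀ (xs : List (Nimber n)) → nimSum xs ≢ 0ᴺ →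
                   Any (λ a → a ⊕ nimSum xs <ᴺ a) xs
nimSum-reducible xs ≢0 = go xs (nimSum xs) refl ≢0
  where
  go : ∀ {n} (xs : List (Nimber n)) s → nimSum xs ≡ s → s ≢ 0ᴺ → Any (λ a → a ⊕ s <ᴺ a) xs
  go xs []          _  ≢0 = contradiction refl ≢0
  go xs (true ∷ t)  eq _  =
    Any.map clear (Any.map⁻ (xor≡true⇒any (map head xs) (cong head (trans (sym (nimSum-∷ xs)) eq))))
    where
    clear : ∀ {a} → head a ≡ true → a ⊕ (true ∷ t) <ᴺ a
    clear {true ∷ a} refl = this Bool.f<t refl
  go xs (false ∷ t) eq ≢0 =
    Any.map keep (Any.map⁻ (go (map tail xs) t (cong tail (trans (sym (nimSum-∷ xs)) eq)) (≢0 ∘ cong (false ∷_))))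
    where
    keep : ∀ {a} → tail a ⊕ t <ᴺ tail a → a ⊕ (false ∷ t) <ᴺ a
    keep {b ∷ a} lt = next (xor-identityʳ b) lt

infix 4 _≟ᴺ_ _<ᴺ?_

-- Written by pattern matching rather than via Data.Vec.Properties.≡-dec,
-- which the type checker evaluates far more slowly in the check below.
_≟ᴺ_ : DecidableEquality (Nimber n)
[]      ≟ᴺ []      = yes refl
(a ∷ x) ≟ᴺ (b ∷ y) with a Boolₚ.≟ b | x ≟ᴺ y
... | yes refl | yes refl = yes refl
... | no a≢b   | _        = no (a≢b ∘ cong head)
... | yes _    | no x≢y   = no (x≢y ∘ cong tail)

_<ᴺ?_ : ∀ (x y : Nimber n) → Dec (x <ᴺ y)
_<ᴺ?_ = <-decidable Boolₚ._≟_ Boolₚ._<?_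

allNimbers : (Nimber n → Bool) → Bool
allNimbers {zero}  p = p []
allNimbers {suc n} p = allNimbers (p ∘ (false ∷_)) ∧ allNimbers (p ∘ (true ∷_))

allNimbers-sound : ∀ (p : Nimber n → Bool) → T (allNimbers p) → ∀ w → T (p w)
allNimbers-sound {zero}  p t []          = t
allNimbers-sound {suc n} p t (false ∷ w) = allNimbers-sound _ (proj₁ (Equivalence.to T-∧ t)) w
allNimbers-sound {suc n} p t (true  ∷ w) = allNimbers-sound _ (proj₂ (Equivalence.to T-∧ t)) w

infix 4 _∈ᵇ_
_∈ᵇ_ : Nimber n → List (Nimber n) → Bool
x ∈ᵇ vs = any (isYes ∘ (x ≟ᴺ_)) vs

∈ᵇ⇒∈ : ∀ {x : Nimber n} vs → T (x ∈ᵇ vs) → x ∈ vs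
∈ᵇ⇒∈ {x = x} vs t = Any.map toWitness (any⁻ (isYes ∘ (x ≟ᴺ_)) vs t)

∈⇒∈ᵇ : ∀ {x : Nimber n} {vs} → x ∈ vs → T (x ∈ᵇ vs)
∈⇒∈ᵇ {x = x} x∈vs = any⁺ (isYes ∘ (x ≟ᴺ_)) (Any.map fromWitness x∈vs)

IsMex : Nimber n → List (Nimber n) → Set
IsMex x vs = x ∉ vs × (∀ {w} → w <ᴺ x → w ∈ vs)

isMexᵇ : Nimber n → List (Nimber n) → Bool
isMexᵇ x vs = not (x ∈ᵇ vs) ∧ allNimbers (λ w → not (isYes (w <ᴺ? x)) ∨ (w ∈ᵇ vs))

isMexᵇ-sound : ∀ (x : Nimber n) vs → T (isMexᵇ x vs) → IsMex x vs
isMexᵇ-sound x vs t = missing , below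
  where
  checks : T (not (x ∈ᵇ vs)) × T (allNimbers (λ w → not (isYes (w <ᴺ? x)) ∨ (w ∈ᵇ vs)))
  checks = Equivalence.to (T-∧ {not (x ∈ᵇ vs)}) t

  missing : x ∉ vs
  missing x∈vs = contradictory (∈⇒∈ᵇ x∈vs) (proj₁ checks)
    where
    contradictory : ∀ {b} → T b → T (not b) → ⊥
    contradictory {true} _ ()

  below : ∀ {w} → w <ᴺ x → w ∈ vs
  below {w} w<x with w <ᴺ? x | allNimbers-sound _ (proj₂ checks) w
  ... | yes _  | w∈ᵇvs = ∈ᵇ⇒∈ vs w∈ᵇvs
  ... | no w≮x | _     = contradiction w<x w≮x

-- Sprague–Grundy theory for positions of long paths

Large : Position → Set
Large = All (4 ≤_)

Positive : Position → Set
Positive = All (1 ≤_)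

large? : Decidable Large
large? = all? (4 ≤?_)

Option : ℕ → Position → Set
Option k r = KaylesMove k r × Large r

positive⇒¬ended : Positive pos → ¬ Ended pos
positive⇒¬ended pos⁺ 0∈pos with () ← All.lookup pos⁺ 0∈pos

large⇒positive : Large pos → Positive pos
large⇒positive = All.map (≤-trans (s≤s z≤n))

kaylesMove-positive : 4 ≤ k → KaylesMove k r → Positive r
kaylesMove-positive (s≤s ())             one
kaylesMove-positive (s≤s (s≤s ()))       two
kaylesMove-positive (s≤s (s≤s (s≤s ()))) three₀
kaylesMove-positive (s≤s (s≤s (s≤s ()))) three₁
kaylesMove-positive _ (endTwo m)          = s≤s z≤n ∷ []
kaylesMove-positive _ (endOne m)          = s≤s z≤n ∷ []
kaylesMove-positive _ (split i j 1≤i i≤j) = 1≤i ∷ ≤-trans 1≤i i≤j ∷ []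

kaylesMove-shrinks : KaylesMove k r → sum r < k
kaylesMove-shrinks one    = s≤s z≤n
kaylesMove-shrinks two    = s≤s z≤n
kaylesMove-shrinks three₀ = s≤s z≤n
kaylesMove-shrinks three₁ = s≤s (s≤s z≤n)
kaylesMove-shrinks (endTwo m)      rewrite +-identityʳ m = s≤s (s≤s (s≤s (n≤1+n m)))
kaylesMove-shrinks (endOne m)      rewrite +-identityʳ m = s≤s (s≤s (m≤n+m m 2))
kaylesMove-shrinks (split i j _ _) rewrite +-identityʳ j = s≤s (m≤n+m (i + j) 2)

move-shrinks : ∀ xs ys → KaylesMove k r → sum (xs ++ r ++ ys) < sum (xs ++ k ∷ ys)
move-shrinks {k} {r} xs ys km rewrite sum-++ xs (r ++ ys) | sum-++ r ys | sum-++ xs (k ∷ ys) =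
  +-monoʳ-< (sum xs) (+-monoˡ-< (sum ys) (kaylesMove-shrinks km))

large-or-small : Positive r → Large r ⊎ ∃[ c ] c ∈ r × 1 ≤ c × c < 4
large-or-small {r} r⁺ with large? r
... | yes large = inj₁ large
... | no ¬large with c , c∈r , c≱4 ← find (¬All⇒Any¬ (4 ≤?_) r ¬large) =
  inj₂ (c , c∈r , All.lookup r⁺ c∈r , ≰⇒> c≱4)

ending-move : 1 ≤ k → k < 4 → KaylesMove k (0 ∷ [])
ending-move {1} _ _ = one
ending-move {2} _ _ = two
ending-move {3} _ _ = three₀
ending-move {suc (suc (suc (suc _)))} _ (s≤s (s≤s (s≤s (s≤s ()))))

small-component⇒IsN : ∀ {c} → Positive pos → c ∈ pos → 1 ≤ c → c < 4 → IsN pos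
small-component⇒IsN pos⁺ c∈pos 1≤c c<4 with xs , ys , refl ← ∈-∃++ c∈pos =
  toP (xs ++ 0 ∷ ys) (positive⇒¬ended pos⁺) (move xs ys _ (0 ∷ []) (ending-move 1≤c c<4))
      (ended (∈-++⁺ʳ xs (here refl)))

IsP⇒¬IsN : IsP pos → ¬ IsN pos
IsP⇒¬IsN (ended e)      (toP _ ¬e _ _)        = ¬e e
IsP⇒¬IsN (allToN _ toN) (toP pos′ _ mv pos′ᴾ) = IsP⇒¬IsN pos′ᴾ (toN pos′ mv)

module _ {n} (g : ℕ → Nimber n) where

  nimValue : Position → Nimber n
  nimValue pos = nimSum (map g pos)

  nimValue-++ : ∀ xs ys → nimValue (xs ++ ys) ≡ nimValue xs ⊕ nimValue ys
  nimValue-++ xs ys = trans (cong nimSum (map-++ g xs ys)) (nimSum-++ (map g xs) (map g ys))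

  nimValue-replace : ∀ xs ys k r →
                     nimValue (xs ++ r ++ ys) ≡ nimValue (xs ++ k ∷ ys) ⊕ (g k ⊕ nimValue r)
  nimValue-replace xs ys k r = begin
    nimValue (xs ++ r ++ ys)          ≡⟨ nimValue-++ xs (r ++ ys) ⟩
    X ⊕ nimValue (r ++ ys)            ≡⟨ cong (X ⊕_) (nimValue-++ r ys) ⟩
    X ⊕ (R ⊕ Y)                       ≡⟨ cong (λ z → X ⊕ (z ⊕ Y)) (⊕-cancelˡ K R) ⟨
    X ⊕ ((K ⊕ (K ⊕ R)) ⊕ Y)           ≡⟨ cong (X ⊕_) (⊕-assoc K (K ⊕ R) Y) ⟩
    X ⊕ (K ⊕ ((K ⊕ R) ⊕ Y))           ≡⟨ cong (λ z → X ⊕ (K ⊕ z)) (⊕-comm (K ⊕ R) Y) ⟩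
    X ⊕ (K ⊕ (Y ⊕ (K ⊕ R)))           ≡⟨ cong (X ⊕_) (⊕-assoc K Y (K ⊕ R)) ⟨
    X ⊕ ((K ⊕ Y) ⊕ (K ⊕ R))           ≡⟨ ⊕-assoc X (K ⊕ Y) (K ⊕ R) ⟨
    (X ⊕ (K ⊕ Y)) ⊕ (K ⊕ R)           ≡⟨ cong (_⊕ (K ⊕ R)) (nimValue-++ xs (k ∷ ys)) ⟨
    nimValue (xs ++ k ∷ ys) ⊕ (K ⊕ R) ∎
    where
    open ≡-Reasoning
    X = nimValue xs
    Y = nimValue ys
    K = g k
    R = nimValue r

  IsGrundyAt : ℕ → Set
  IsGrundyAt k = (∀ {r} → Option k r → nimValue r ≢ g k)
               × (∀ {w} → w <ᴺ g k → ∃[ r ] Option k r × nimValue r ≡ w)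

  IsGrundy : Set
  IsGrundy = ∀ k → IsGrundyAt k

  NimSumRule : Position → Set
  NimSumRule pos = (nimValue pos ≡ 0ᴺ → IsP pos) × (nimValue pos ≢ 0ᴺ → IsN pos)

  module _ (grundy : IsGrundy) where

    private
      SmallerRule : Position → Set
      SmallerRule = WF.WfRec (_<_ on sum) (λ pos → Large pos → NimSumRule pos)

    move-from-zero⇒IsN : ∀ {pos pos′} → SmallerRule pos → Large pos → nimValue pos ≡ 0ᴺ →
                         Move pos pos′ → IsN pos′
    move-from-zero⇒IsN ih large v≡0 (move xs ys k r km)
      with 4≤k ∷ ys-large ← ++⁻ʳ xs large
      with large-or-small (kaylesMove-positive 4≤k km)
    ... | inj₂ (c , c∈r , 1≤c , c<4) =
      small-component⇒IsN positive (∈-++⁺ʳ xs (∈-++⁺ˡ c∈r)) 1≤c c<4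
      where
      positive = ++⁺ (large⇒positive (++⁻ˡ xs large))
                     (++⁺ (kaylesMove-positive 4≤k km) (large⇒positive ys-large))
    ... | inj₁ r-large =
      proj₂ (ih (move-shrinks xs ys km) (++⁺ (++⁻ˡ xs large) (++⁺ r-large ys-large))) nonzero
      where
      nonzero : nimValue (xs ++ r ++ ys) ≢ 0ᴺ
      nonzero v′≡0 = proj₁ (grundy k) (km , r-large) (sym (⊕≡0⇒≡ (begin
        g k ⊕ nimValue r                             ≡⟨ ⊕-identityˡ _ ⟨
        0ᴺ ⊕ (g k ⊕ nimValue r)                      ≡⟨ cong (_⊕ (g k ⊕ nimValue r)) v≡0 ⟨
        nimValue (xs ++ k ∷ ys) ⊕ (g k ⊕ nimValue r) ≡⟨ nimValue-replace xs ys k r ⟨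
        nimValue (xs ++ r ++ ys)                     ≡⟨ v′≡0 ⟩
        0ᴺ                                           ∎)))
        where open ≡-Reasoning

    nonzero⇒IsN : ∀ {pos} → SmallerRule pos → Large pos → nimValue pos ≢ 0ᴺ → IsN pos
    nonzero⇒IsN {pos} ih large v≢0
      with c , c∈pos , reduces ← find (Any.map⁻ (nimSum-reducible (map g pos) v≢0))
      with xs , ys , refl ← ∈-∃++ c∈pos
      with r , (km , r-large) , r-value ← proj₂ (grundy c) reduces =
      toP (xs ++ r ++ ys) (positive⇒¬ended (large⇒positive large)) (move xs ys c r km)
          (proj₁ (ih (move-shrinks xs ys km)
                     (++⁺ (++⁻ˡ xs large) (++⁺ r-large (++⁻ʳ (c ∷ []) (++⁻ʳ xs large)))))
                 cleared)
      where
      s = nimValue (xs ++ c ∷ ys)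
      cleared : nimValue (xs ++ r ++ ys) ≡ 0ᴺ
      cleared = begin
        nimValue (xs ++ r ++ ys) ≡⟨ nimValue-replace xs ys c r ⟩
        s ⊕ (g c ⊕ nimValue r)   ≡⟨ cong (λ v → s ⊕ (g c ⊕ v)) r-value ⟩
        s ⊕ (g c ⊕ (g c ⊕ s))    ≡⟨ cong (s ⊕_) (⊕-cancelˡ (g c) s) ⟩
        s ⊕ s                    ≡⟨ ⊕-self s ⟩
        0ᴺ                       ∎
        where open ≡-Reasoning

    large⇒nimSumRule : ∀ pos → Large pos → NimSumRule pos
    large⇒nimSumRule = WF.All.wfRec (On.wellFounded sum <-wellFounded) _ _ λ pos ih large →
      (λ v≡0 → allToN (positive⇒¬ended (large⇒positive large)) (λ _ → move-from-zero⇒IsN ih large v≡0))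
      , nonzero⇒IsN ih large

    path-IsP⇔ : ∀ n → IsP (n ∷ []) ⇔ (n ≡ 0 ⊎ (4 ≤ n × g n ≡ 0ᴺ))
    path-IsP⇔ zero = mk⇔ (λ _ → inj₁ refl) (λ _ → ended (here refl))
    path-IsP⇔ n@(suc _) with 4 ≤? n
    ... | no n≱4 = mk⇔
      (λ nᴾ → contradiction (small-component⇒IsN (s≤s z≤n ∷ []) (here refl) (s≤s z≤n) (≰⇒> n≱4))
                            (IsP⇒¬IsN nᴾ))
      λ where (inj₁ ())
              (inj₂ (4≤n , _)) → contradiction 4≤n n≱4
    ... | yes 4≤n = mk⇔ (λ nᴾ → inj₂ (4≤n , zero-value nᴾ))
                        λ where (inj₁ ())
                                (inj₂ (_ , gn≡0)) → proj₁ rule (trans (⊕-identityʳ (g n)) gn≡0)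
      where
      rule = large⇒nimSumRule (n ∷ []) (4≤n ∷ [])
      zero-value : IsP (n ∷ []) → g n ≡ 0ᴺ
      zero-value nᴾ with g n ≟ᴺ 0ᴺ
      ... | yes gn≡0 = gn≡0
      ... | no  gn≢0 = contradiction (proj₂ rule (gn≢0 ∘ trans (sym (⊕-identityʳ (g n))))) (IsP⇒¬IsN nᴾ)

-- The options of a path

≤⌊/2⌋⇒+≤ : ∀ {i s} → i ≤ ⌊ s /2⌋ → i + i ≤ s
≤⌊/2⌋⇒+≤ {i} {s} i≤h =
  ≤-trans (+-mono-≤ i≤h (≤-trans i≤h (⌊n/2⌋≤⌈n/2⌉ s))) (≤-reflexive (⌊n/2⌋+⌈n/2⌉≡n s))

+≤⇒≤⌊/2⌋ : ∀ {i s} → i + i ≤ s → i ≤ ⌊ s /2⌋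
+≤⇒≤⌊/2⌋ {i} i+i≤s = subst (_≤ _) (sym (n≡⌊n+n/2⌋ i)) (⌊n/2⌋-mono i+i≤s)

<∸⇒+< : ∀ {t h} c → t < h ∸ c → c + t < h
<∸⇒+< {h = suc h} zero    t<h   = t<h
<∸⇒+< {h = suc h} (suc c) t<h∸c = s≤s (<∸⇒+< c t<h∸c)

largeSplitAt : ℕ → ℕ → Position
largeSplitAt s t = 4 + t ∷ s ∸ (4 + t) ∷ []

-- The pairs P_i, P_j with 4 ≤ i ≤ j and i + j = s, listed by t = i ∸ 4.
largeSplits : ℕ → List Position
largeSplits s = applyDownFrom (largeSplitAt s) (⌊ s /2⌋ ∸ 3)

endMoves : ℕ → List Position
endMoves m = (2 + m ∷ []) ∷ (1 + m ∷ []) ∷ []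

largeOptions : ℕ → List Position
largeOptions (suc (suc (suc (suc m)))) = filter large? (endMoves m) ++ largeSplits (1 + m)
largeOptions _ = []

largeSplits-sound : ∀ s → r ∈ largeSplits s → Option (3 + s) r
largeSplits-sound s r∈ with t , t<c , refl ← ∈-applyDownFrom⁻ (largeSplitAt s) r∈ =
  subst (λ k → KaylesMove k (largeSplitAt s t)) (cong (3 +_) (m+[n∸m]≡n i≤s)) (split i (s ∸ i) (s≤s z≤n) i≤j) ,
  (s≤s (s≤s (s≤s (s≤s z≤n))) ∷ ≤-trans (s≤s (s≤s (s≤s (s≤s z≤n)))) i≤j ∷ [])
  where
  i = 4 + t
  i≤h : i ≤ ⌊ s /2⌋
  i≤h = <∸⇒+< 3 t<c
  i≤j : i ≤ s ∸ i
  i≤j = m+n≤o⇒m≤o∸n i (≤⌊/2⌋⇒+≤ i≤h)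
  i≤s : i ≤ s
  i≤s = ≤-trans (m≤m+n i i) (≤⌊/2⌋⇒+≤ i≤h)

largeSplits-complete : ∀ i j → 4 + i ≤ j → (4 + i ∷ j ∷ []) ∈ largeSplits (4 + i + j)
largeSplits-complete i j i≤j =
  subst (λ j′ → (4 + i ∷ j′ ∷ []) ∈ largeSplits (4 + i + j)) (m+n∸m≡n (4 + i) j)
    (∈-applyDownFrom⁺ (largeSplitAt (4 + i + j))
      (∸-monoˡ-≤ 3 (+≤⇒≤⌊/2⌋ {4 + i} {4 + i + j} (+-monoʳ-≤ (4 + i) i≤j))))

largeOptions-sound : r ∈ largeOptions k → Option k r
largeOptions-sound {k = suc (suc (suc (suc m)))} r∈ with ∈-++⁻ (filter large? (endMoves m)) r∈
... | inj₂ r∈splits = largeSplits-sound (1 + m) r∈splits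
... | inj₁ r∈ends with ∈-filter⁻ large? {xs = endMoves m} r∈ends
...   | here refl         , large = endTwo m , large
...   | there (here refl) , large = endOne m , large

largeOptions-complete : Option k r → r ∈ largeOptions k
largeOptions-complete (one    , () ∷ [])
largeOptions-complete (two    , () ∷ [])
largeOptions-complete (three₀ , () ∷ [])
largeOptions-complete (three₁ , s≤s () ∷ [])
largeOptions-complete (endTwo m , large) = ∈-++⁺ˡ (∈-filter⁺ large? {xs = endMoves m} (here refl) large)
largeOptions-complete (endOne m , large) = ∈-++⁺ˡ (∈-filter⁺ large? {xs = endMoves m} (there (here refl)) large)
largeOptions-complete (split 1 j _ _ , s≤s () ∷ _)
largeOptions-complete (split 2 j _ _ , s≤s (s≤s ()) ∷ _)
largeOptions-complete (split 3 j _ _ , s≤s (s≤s (s≤s ())) ∷ _)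
largeOptions-complete (split (suc (suc (suc (suc i)))) j _ i≤j , _) =
  ∈-++⁺ʳ (filter large? (endMoves (3 + (i + j)))) (largeSplits-complete i j i≤j)

module _ {n} (g : ℕ → Nimber n) where

  optionValues : ℕ → List (Nimber n)
  optionValues k = map (nimValue g) (largeOptions k)

  mex⇒IsGrundyAt : ∀ k → IsMex (g k) (optionValues k) → IsGrundyAt g k
  mex⇒IsGrundyAt k (missing , below) =
    (λ option v≡gk → missing (subst (_∈ optionValues k) v≡gk (∈-map⁺ (nimValue g) (largeOptions-complete option))))
    , λ w<gk → case ∈-map⁻ (nimValue g) (below w<gk) of λ where
        (r , r∈ , refl) → r , largeOptions-sound r∈ , refl

-- Periodicity

module _ {A : Set} where

  Periodic : (n₀ p : ℕ) → (ℕ → A) → Set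
  Periodic n₀ p f = ∀ k → n₀ ≤ k → f (p + k) ≡ f k

  periodicExtension : (n₀ p : ℕ) .{{_ : NonZero p}} → (ℕ → A) → ℕ → A
  periodicExtension n₀ p t k = if k <ᵇ n₀ then t k else t (n₀ + (k ∸ n₀) % p)

  module _ {n₀ p : ℕ} .{{_ : NonZero p}} {t : ℕ → A} where

    periodicExtension-≥ : ∀ {k} → n₀ ≤ k → periodicExtension n₀ p t k ≡ t (n₀ + (k ∸ n₀) % p)
    periodicExtension-≥ {k} n₀≤k with k <ᵇ n₀ in k<ᵇn₀
    ... | false = refl
    ... | true  = contradiction (<ᵇ⇒< k n₀ (subst T (sym k<ᵇn₀) tt)) (≤⇒≯ n₀≤k)

    periodicExtension-periodic : Periodic n₀ p (periodicExtension n₀ p t)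
    periodicExtension-periodic k n₀≤k = begin
      periodicExtension n₀ p t (p + k) ≡⟨ periodicExtension-≥ (≤-trans n₀≤k (m≤n+m k p)) ⟩
      t (n₀ + (p + k ∸ n₀) % p)        ≡⟨ cong (λ x → t (n₀ + x % p)) (+-∸-assoc p n₀≤k) ⟩
      t (n₀ + (p + (k ∸ n₀)) % p)      ≡⟨ cong (λ x → t (n₀ + x % p)) (+-comm p (k ∸ n₀)) ⟩
      t (n₀ + (k ∸ n₀ + p) % p)        ≡⟨ cong (λ x → t (n₀ + x)) ([m+n]%n≡m%n (k ∸ n₀) p) ⟩
      t (n₀ + (k ∸ n₀) % p)            ≡⟨ periodicExtension-≥ n₀≤k ⟨
      periodicExtension n₀ p t k       ∎
      where open ≡-Reasoning

endTwo-option : ∀ {k} → 6 ≤ k → Option k (k ∸ 2 ∷ [])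
endTwo-option {suc (suc (suc (suc m)))} (s≤s (s≤s (s≤s (s≤s 2≤m)))) = endTwo m , s≤s (s≤s 2≤m) ∷ []

endOne-option : ∀ {k} → 7 ≤ k → Option k (k ∸ 3 ∷ [])
endOne-option {suc (suc (suc (suc m)))} (s≤s (s≤s (s≤s (s≤s 3≤m)))) = endOne m , s≤s 3≤m ∷ []

≤-half : ∀ {x i j} → i ≤ j → x + x ≤ i + j → x ≤ j
≤-half {x} {i} {j} i≤j x+x≤i+j with x ≤? j
... | yes x≤j = x≤j
... | no  x≰j = contradiction x+x≤i+j (<⇒≱ (+-mono-< (≤-<-trans i≤j (≰⇒> x≰j)) (≰⇒> x≰j)))

split-shift : ∀ p i j → 3 + (i + (p + j)) ≡ p + (3 + (i + j))
split-shift = solve-∀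

module _ {n} (g : ℕ → Nimber n) where

  split-option : ∀ {i j} → 4 ≤ i → 4 ≤ j →
                 ∃[ r ] Option (3 + (i + j)) r × nimValue g r ≡ nimValue g (i ∷ j ∷ [])
  split-option {i} {j} 4≤i 4≤j with i ≤? j
  ... | yes i≤j = _ , (split i j (≤-trans (s≤s z≤n) 4≤i) i≤j , 4≤i ∷ 4≤j ∷ []) , refl
  ... | no  i≰j =
    _ , (subst (λ k → KaylesMove k (j ∷ i ∷ [])) (cong (3 +_) (+-comm j i))
               (split j i (≤-trans (s≤s z≤n) 4≤j) (<⇒≤ (≰⇒> i≰j)))
        , 4≤j ∷ 4≤i ∷ [])
      , swap
    where
    swap : g j ⊕ (g i ⊕ 0ᴺ) ≡ g i ⊕ (g j ⊕ 0ᴺ)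
    swap = begin
      g j ⊕ (g i ⊕ 0ᴺ) ≡⟨ ⊕-assoc (g j) (g i) 0ᴺ ⟨
      (g j ⊕ g i) ⊕ 0ᴺ ≡⟨ cong (_⊕ 0ᴺ) (⊕-comm (g j) (g i)) ⟩
      (g i ⊕ g j) ⊕ 0ᴺ ≡⟨ ⊕-assoc (g i) (g j) 0ᴺ ⟩
      g i ⊕ (g j ⊕ 0ᴺ) ∎
      where open ≡-Reasoning

  -- Under the bounds below, the longer part of a split is at least n₀ when
  -- raising and n₀ + p when lowering, so it can be shifted by p without
  -- changing its Grundy value.
  module _ {n₀ p} (4≤n₀ : 4 ≤ n₀) (periodic : Periodic n₀ p g) where

    private
      n₀+3≤ : ∀ {k} → n₀ + n₀ + 3 ≤ k → n₀ + 3 ≤ k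
      n₀+3≤ = ≤-trans (+-monoˡ-≤ 3 (m≤m+n n₀ n₀))

      drop-p : ∀ {k} → n₀ + n₀ + p + 3 ≤ k → n₀ + n₀ + 3 ≤ k
      drop-p = ≤-trans (+-monoˡ-≤ 3 (m≤m+n (n₀ + n₀) p))

      7≤ : ∀ {k} → n₀ + 3 ≤ k → 7 ≤ k
      7≤ = ≤-trans (+-monoˡ-≤ 3 4≤n₀)

      shifted-end : ∀ c k → c ≤ 3 → n₀ + 3 ≤ k → g (p + k ∸ c) ≡ g (k ∸ c)
      shifted-end c k c≤3 n₀+3≤k =
        trans (cong g (+-∸-assoc p (≤-trans (m≤n+m c n₀) n₀+c≤k)))
              (periodic (k ∸ c) (m+n≤o⇒m≤o∸n n₀ n₀+c≤k))
        where n₀+c≤k = ≤-trans (+-monoʳ-≤ n₀ c≤3) n₀+3≤k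

    raise-option : ∀ {k r} → n₀ + n₀ + 3 ≤ k → Option k r →
                   ∃[ r′ ] Option (p + k) r′ × nimValue g r′ ≡ nimValue g r
    raise-option _ (one    , () ∷ [])
    raise-option _ (two    , () ∷ [])
    raise-option _ (three₀ , () ∷ [])
    raise-option _ (three₁ , s≤s () ∷ [])
    raise-option {k} bound (endTwo m , 4≤2+m ∷ []) =
      _ , endTwo-option (≤-trans (s≤s (s≤s 4≤2+m)) (m≤n+m k p))
        , cong (_⊕ 0ᴺ) (shifted-end 2 k (s≤s (s≤s z≤n)) (n₀+3≤ bound))
    raise-option {k} bound (endOne m , 4≤1+m ∷ []) =
      _ , endOne-option (≤-trans (s≤s (s≤s (s≤s 4≤1+m))) (m≤n+m k p))
        , cong (_⊕ 0ᴺ) (shifted-end 3 k ≤-refl (n₀+3≤ bound))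
    raise-option bound (split i j _ i≤j , 4≤i ∷ 4≤j ∷ []) =
      let r′ , option , r′-value = split-option 4≤i (≤-trans 4≤j (m≤n+m j p))
      in r′ , subst (λ k → Option k r′) (split-shift p i j) option
            , trans r′-value (cong (λ x → g i ⊕ (x ⊕ 0ᴺ)) (periodic j n₀≤j))
      where
      n₀≤j : n₀ ≤ j
      n₀≤j = ≤-half i≤j (+-cancelˡ-≤ 3 _ _ (subst (_≤ 3 + (i + j)) (+-comm (n₀ + n₀) 3) bound))

    lower-option : ∀ {K k r} → K ≡ p + k → n₀ + n₀ + p + 3 ≤ k → Option K r →
                   ∃[ r′ ] Option k r′ × nimValue g r′ ≡ nimValue g r
    lower-option _ _ (one    , () ∷ [])
    lower-option _ _ (two    , () ∷ [])
    lower-option _ _ (three₀ , () ∷ [])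
    lower-option _ _ (three₁ , s≤s () ∷ [])
    lower-option {k = k} K≡p+k bound (endTwo m , _) =
      _ , endTwo-option (≤-trans (n≤1+n 6) (7≤ n₀+3≤k))
        , cong (_⊕ 0ᴺ) (sym (trans (cong (λ K → g (K ∸ 2)) K≡p+k) (shifted-end 2 k (s≤s (s≤s z≤n)) n₀+3≤k)))
      where n₀+3≤k = n₀+3≤ (drop-p bound)
    lower-option {k = k} K≡p+k bound (endOne m , _) =
      _ , endOne-option (7≤ n₀+3≤k)
        , cong (_⊕ 0ᴺ) (sym (trans (cong (λ K → g (K ∸ 3)) K≡p+k) (shifted-end 3 k ≤-refl n₀+3≤k)))
      where n₀+3≤k = n₀+3≤ (drop-p bound)
    lower-option {k = k} K≡p+k bound (split i j _ i≤j , 4≤i ∷ 4≤j ∷ []) =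
      let r′ , option , r′-value = split-option 4≤i (≤-trans 4≤n₀ n₀≤j′)
      in r′ , subst (λ k → Option k r′) k′≡k option
            , trans r′-value (cong (λ x → g i ⊕ (x ⊕ 0ᴺ)) (sym g-j))
      where
      n₀+p≤j : n₀ + p ≤ j
      n₀+p≤j = ≤-half i≤j (+-cancelˡ-≤ 3 _ _ (begin
        3 + ((n₀ + p) + (n₀ + p)) ≡⟨ rearrange n₀ p ⟩
        p + (n₀ + n₀ + p + 3)     ≤⟨ +-monoʳ-≤ p bound ⟩
        p + k                     ≡⟨ K≡p+k ⟨
        3 + (i + j)               ∎))
        where
        open ≤-Reasoning
        rearrange : ∀ n₀ p → 3 + ((n₀ + p) + (n₀ + p)) ≡ p + (n₀ + n₀ + p + 3)
        rearrange = solve-∀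
      j′ = j ∸ p
      p+j′≡j : p + j′ ≡ j
      p+j′≡j = m+[n∸m]≡n (≤-trans (m≤n+m p n₀) n₀+p≤j)
      n₀≤j′ : n₀ ≤ j′
      n₀≤j′ = m+n≤o⇒m≤o∸n n₀ n₀+p≤j
      g-j : g j ≡ g j′
      g-j = trans (cong g (sym p+j′≡j)) (periodic j′ n₀≤j′)
      k′≡k : 3 + (i + j′) ≡ k
      k′≡k = +-cancelˡ-≡ p _ _ (begin
        p + (3 + (i + j′)) ≡⟨ split-shift p i j′ ⟨
        3 + (i + (p + j′)) ≡⟨ cong (λ x → 3 + (i + x)) p+j′≡j ⟩
        3 + (i + j)        ≡⟨ K≡p+k ⟩
        p + k              ∎)
        where open ≡-Reasoning

    periodic⇒IsGrundy : .{{_ : NonZero p}} →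
                        (∀ k → k < p + (n₀ + n₀ + p + 3) → IsGrundyAt g k) → IsGrundy g
    periodic⇒IsGrundy verified = <-rec (IsGrundyAt g) step
      where
      step : ∀ k → (∀ {k′} → k′ < k → IsGrundyAt g k′) → IsGrundyAt g k
      step k ih with k <? p + (n₀ + n₀ + p + 3)
      ... | yes k<bound = verified k k<bound
      ... | no  k≮bound = no-equal-option , all-smaller-options
        where
        bound≤k = ≮⇒≥ k≮bound
        k′ = k ∸ p
        k≡p+k′ : k ≡ p + k′
        k≡p+k′ = sym (m+[n∸m]≡n (≤-trans (m≤m+n p _) bound≤k))
        bound≤k′ : n₀ + n₀ + p + 3 ≤ k′
        bound≤k′ = m+n≤o⇒m≤o∸n _ (subst (_≤ k) (+-comm p _) bound≤k)
        gk≡gk′ : g k ≡ g k′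
        gk≡gk′ = trans (cong g k≡p+k′)
                       (periodic k′ (≤-trans (m≤m+n n₀ 3) (n₀+3≤ (drop-p bound≤k′))))
        k′-grundy = ih (subst (k′ <_) (sym k≡p+k′) (m<n+m k′ (>-nonZero⁻¹ p)))
        no-equal-option : ∀ {r} → Option k r → nimValue g r ≢ g k
        no-equal-option option v≡gk =
          let r′ , option′ , r′-value = lower-option k≡p+k′ bound≤k′ option
          in proj₁ k′-grundy option′ (trans r′-value (trans v≡gk gk≡gk′))
        all-smaller-options : ∀ {w} → w <ᴺ g k → ∃[ r ] Option k r × nimValue g r ≡ w
        all-smaller-options w<gk =
          let r′ , option′ , r′-value = proj₂ k′-grundy (subst (_ <ᴺ_) gk≡gk′ w<gk)
              r″ , option″ , r″-value = raise-option (drop-p bound≤k′) option′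
          in r″ , subst (λ k → Option k r″) (sym k≡p+k′) option″ , trans r″-value r′-value

-- The Grundy values of the game

decide : ∀ {A : Set} (a? : Dec A) → isYes a? ≡ true → A
decide a? isYes≡true = toWitness (subst T (sym isYes≡true) tt)

-- Generic in p and m, so that an expensive check enters only as an equation
-- proved by refl: elaborating a type such as T (all p (upTo m)) for concrete
-- p and m would normalise it far more slowly.
all-upTo-sound : ∀ (p : ℕ → Bool) m → all p (upTo m) ≡ true → ∀ {k} → k < m → T (p k)
all-upTo-sound p m all≡true k<m = All.lookup (all⁺ p (upTo m) (subst T (sym all≡true) tt)) (∈-upTo⁺ k<m)

nimber : ∀ n → ℕ → Nimber n
nimber zero    m = []
nimber (suc n) m = if 2 ^ n ≤ᵇ m then true ∷ nimber n (m ∸ 2 ^ n) else false ∷ nimber n m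

-- g(0), …, g(328), seven per row.
grundyRows : List (List ℕ)
grundyRows =
  (0 ∷ 0 ∷ 0 ∷ 0 ∷ 0 ∷ 0 ∷ 1 ∷ []) ∷
  (1 ∷ 2 ∷ 0 ∷ 0 ∷ 1 ∷ 1 ∷ 2 ∷ []) ∷
  (0 ∷ 3 ∷ 1 ∷ 1 ∷ 2 ∷ 2 ∷ 3 ∷ []) ∷
  (1 ∷ 1 ∷ 2 ∷ 3 ∷ 3 ∷ 4 ∷ 1 ∷ []) ∷
  (0 ∷ 5 ∷ 3 ∷ 4 ∷ 1 ∷ 5 ∷ 5 ∷ []) ∷
  (3 ∷ 4 ∷ 2 ∷ 5 ∷ 5 ∷ 3 ∷ 2 ∷ []) ∷
  (2 ∷ 5 ∷ 5 ∷ 3 ∷ 2 ∷ 2 ∷ 5 ∷ []) ∷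
  (5 ∷ 0 ∷ 2 ∷ 2 ∷ 5 ∷ 0 ∷ 4 ∷ []) ∷
  (2 ∷ 2 ∷ 5 ∷ 3 ∷ 4 ∷ 4 ∷ 2 ∷ []) ∷
  (3 ∷ 3 ∷ 4 ∷ 4 ∷ 2 ∷ 5 ∷ 3 ∷ []) ∷
  (4 ∷ 4 ∷ 5 ∷ 5 ∷ 3 ∷ 4 ∷ 1 ∷ []) ∷
  (5 ∷ 5 ∷ 3 ∷ 4 ∷ 2 ∷ 8 ∷ 5 ∷ []) ∷
  (3 ∷ 2 ∷ 2 ∷ 8 ∷ 5 ∷ 3 ∷ 4 ∷ []) ∷
  (2 ∷ 8 ∷ 5 ∷ 4 ∷ 4 ∷ 2 ∷ 8 ∷ []) ∷
  (0 ∷ 4 ∷ 4 ∷ 2 ∷ 8 ∷ 3 ∷ 4 ∷ []) ∷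
  (4 ∷ 2 ∷ 2 ∷ 3 ∷ 4 ∷ 4 ∷ 2 ∷ []) ∷
  (5 ∷ 3 ∷ 3 ∷ 4 ∷ 5 ∷ 5 ∷ 3 ∷ []) ∷
  (3 ∷ 1 ∷ 2 ∷ 5 ∷ 3 ∷ 3 ∷ 2 ∷ []) ∷
  (2 ∷ 5 ∷ 3 ∷ 3 ∷ 2 ∷ 2 ∷ 5 ∷ []) ∷
  (3 ∷ 4 ∷ 2 ∷ 2 ∷ 5 ∷ 3 ∷ 4 ∷ []) ∷
  (2 ∷ 2 ∷ 5 ∷ 3 ∷ 4 ∷ 2 ∷ 2 ∷ []) ∷
  (3 ∷ 3 ∷ 4 ∷ 2 ∷ 2 ∷ 3 ∷ 3 ∷ []) ∷
  (4 ∷ 2 ∷ 5 ∷ 3 ∷ 3 ∷ 4 ∷ 4 ∷ []) ∷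
  (5 ∷ 3 ∷ 3 ∷ 4 ∷ 2 ∷ 5 ∷ 5 ∷ []) ∷
  (3 ∷ 2 ∷ 2 ∷ 5 ∷ 5 ∷ 3 ∷ 4 ∷ []) ∷
  (2 ∷ 5 ∷ 5 ∷ 4 ∷ 4 ∷ 2 ∷ 5 ∷ []) ∷
  (5 ∷ 4 ∷ 4 ∷ 2 ∷ 5 ∷ 3 ∷ 4 ∷ []) ∷
  (4 ∷ 2 ∷ 2 ∷ 3 ∷ 4 ∷ 4 ∷ 2 ∷ []) ∷
  (5 ∷ 3 ∷ 3 ∷ 4 ∷ 5 ∷ 5 ∷ 3 ∷ []) ∷
  (3 ∷ 1 ∷ 2 ∷ 5 ∷ 3 ∷ 4 ∷ 2 ∷ []) ∷
  (2 ∷ 5 ∷ 3 ∷ 3 ∷ 2 ∷ 2 ∷ 5 ∷ []) ∷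
  (3 ∷ 4 ∷ 2 ∷ 2 ∷ 5 ∷ 3 ∷ 4 ∷ []) ∷
  (2 ∷ 2 ∷ 5 ∷ 3 ∷ 4 ∷ 2 ∷ 2 ∷ []) ∷
  (3 ∷ 3 ∷ 4 ∷ 2 ∷ 2 ∷ 3 ∷ 3 ∷ []) ∷
  (4 ∷ 2 ∷ 5 ∷ 3 ∷ 3 ∷ 4 ∷ 4 ∷ []) ∷
  -- the period g(245), …, g(328)
  (5 ∷ 3 ∷ 3 ∷ 4 ∷ 2 ∷ 5 ∷ 5 ∷ []) ∷
  (3 ∷ 2 ∷ 2 ∷ 5 ∷ 5 ∷ 3 ∷ 4 ∷ []) ∷
  (2 ∷ 5 ∷ 3 ∷ 4 ∷ 4 ∷ 2 ∷ 5 ∷ []) ∷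
  (5 ∷ 4 ∷ 4 ∷ 2 ∷ 5 ∷ 3 ∷ 4 ∷ []) ∷
  (4 ∷ 2 ∷ 5 ∷ 3 ∷ 4 ∷ 4 ∷ 2 ∷ []) ∷
  (5 ∷ 3 ∷ 3 ∷ 4 ∷ 5 ∷ 5 ∷ 3 ∷ []) ∷
  (3 ∷ 4 ∷ 2 ∷ 5 ∷ 3 ∷ 4 ∷ 2 ∷ []) ∷
  (2 ∷ 5 ∷ 3 ∷ 3 ∷ 2 ∷ 2 ∷ 5 ∷ []) ∷
  (3 ∷ 4 ∷ 2 ∷ 2 ∷ 5 ∷ 3 ∷ 4 ∷ []) ∷
  (2 ∷ 2 ∷ 5 ∷ 3 ∷ 4 ∷ 2 ∷ 2 ∷ []) ∷
  (3 ∷ 3 ∷ 4 ∷ 2 ∷ 2 ∷ 3 ∷ 3 ∷ []) ∷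
  (4 ∷ 2 ∷ 5 ∷ 3 ∷ 3 ∷ 4 ∷ 2 ∷ []) ∷
  []

-- d is a junk value for indices beyond the end of the list.
at : ∀ {A : Set} → A → List A → ℕ → A
at d []       _       = d
at d (x ∷ _)  zero    = x
at d (_ ∷ xs) (suc i) = at d xs i

grundyTable : ℕ → Nimber 4
grundyTable i = nimber 4 (at 0 (at [] grundyRows (i / 7)) (i % 7))

grundy : ℕ → Nimber 4
grundy = periodicExtension 245 84 grundyTable

mexCheck : ℕ → Bool
mexCheck k = isMexᵇ (grundy k) (optionValues grundy k)

grundy-isGrundy : IsGrundy grundy
grundy-isGrundy = periodic⇒IsGrundy grundy {245} {84} (s≤s (s≤s (s≤s (s≤s z≤n)))) periodicExtension-periodic
  λ k k<661 → mex⇒IsGrundyAt grundy k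
                (isMexᵇ-sound (grundy k) (optionValues grundy k) (all-upTo-sound mexCheck 661 refl k<661))

pathPPositions : List ℕ
pathPPositions = 0 ∷ 4 ∷ 5 ∷ 9 ∷ 10 ∷ 14 ∷ 28 ∷ 50 ∷ 54 ∷ 98 ∷ []

pathPPositions-zero : All (λ k → 4 ≤ k × grundy k ≡ 0ᴺ) (drop 1 pathPPositions)
pathPPositions-zero = decide (all? (λ k → 4 ≤? k ×-dec grundy k ≟ᴺ 0ᴺ) (drop 1 pathPPositions)) refl

preperiod-zeros : All (λ k → 4 ≤ k → grundy k ≡ 0ᴺ → k ∈ pathPPositions) (upTo 245)
preperiod-zeros =
  decide (all? (λ k → 4 ≤? k →-dec (grundy k ≟ᴺ 0ᴺ →-dec k ∈? pathPPositions)) (upTo 245)) refl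

period-nonzero : All (λ i → grundyTable (245 + i) ≢ 0ᴺ) (upTo 84)
period-nonzero = decide (all? (λ i → ¬? (grundyTable (245 + i) ≟ᴺ 0ᴺ)) (upTo 84)) refl

grundy-zero⇒∈ : 4 ≤ k → grundy k ≡ 0ᴺ → k ∈ pathPPositions
grundy-zero⇒∈ {k} 4≤k gk≡0 with k <? 245
... | yes k<245 = All.lookup preperiod-zeros (∈-upTo⁺ k<245) 4≤k gk≡0
... | no  k≮245 =
  contradiction (trans (sym (periodicExtension-≥ {n₀ = 245} {p = 84} {t = grundyTable} (≮⇒≥ k≮245))) gk≡0)
                (All.lookup period-nonzero (∈-upTo⁺ (m%n<n (k ∸ 245) 84)))

∈⇒grundy-zero : k ∈ pathPPositions → k ≡ 0 ⊎ (4 ≤ k × grundy k ≡ 0ᴺ)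
∈⇒grundy-zero (here refl) = inj₁ refl
∈⇒grundy-zero (there k∈)  = inj₂ (All.lookup pathPPositions-zero k∈)

corollary1 : (n : ℕ) →
    IsP (n ∷ []) ⇔ (n ∈ (0 ∷ 4 ∷ 5 ∷ 9 ∷ 10 ∷ 14 ∷ 28 ∷ 50 ∷ 54 ∷ 98 ∷ []))
corollary1 n = mk⇔ (λ nᴾ → case Equivalence.to path nᴾ of λ where
                      (inj₁ refl)         → here refl
                      (inj₂ (4≤n , gn≡0)) → grundy-zero⇒∈ 4≤n gn≡0)
                   (Equivalence.from path ∘ ∈⇒grundy-zero)
  where
  path = path-IsP⇔ grundy grundy-isGrundy n
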